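{- For any nonnegative integers $k,r$ and positive integers $\ell,N$, there exists an integer $N^*\ge N$ such that the following holds. Let $G$ be a graph, $S\subseteq V(G)$ with $|S|\le k$, and $Z\subseteq N_G^{\le r}[S]$. Let $m$ be a positive integer, $c_Z:Z\to[m]$, and let $c$ be an $m$-coloring of $(G-Z)^\ell$ with weak diameter in $(G-Z)^\ell$ at most $N$. Then the $m$-coloring $c\cup c_Z$ of $G^\ell$ has weak diameter in $G^\ell$ at most $N^*$.
   Context: All graphs are finite. $N_G^{\le r}[S]$ is the set of vertices $v$ of $G$ such that there is a path in $G$ from $v$ to $S$ with at most $r$ edges. $G^\ell$ is obtained from $G$ by adding an edge between every two distinct vertices at distance at most $\ell$ in $G$. An $m$-coloring of a graph $H$ is a function $V(H)\to[m]$; a $c$-monochromatic component in $H$ is a component of the subgraph of $H$ induced by one color class; $c$ has weak diameter in $H$ at most $d$ if any two vertices in a common $c$-monochromatic component in $H$ are at distance at most $d$ in $H$. $c\cup c_Z$ denotes the function on $V(G)$ agreeing with $c$ on $V(G)-Z$ and with $c_Z$ on $Z$. -}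

module Defs where

open import Data.Nat using (ℕ; zero; suc; _≤_)
open import Data.Fin using (Fin)
open import Data.Fin.Subset using (Subset; _∈_; _∉_)
open import Data.Vec using (lookup)
open import Data.Bool using (if_then_else_)
open import Data.Product using (Σ; _×_; _,_)
open import Data.Unit using (⊤)
import Data.Empty
open import Relation.Binary.PropositionalEquality using (_≡_; _≢_)

record Graph (n : ℕ) : Set₁ where
  field
    Adj   : Fin n → Fin n → Set
    sym   : ∀ {u v} → Adj u v → Adj v u
    irrefl : ∀ {v} → Adj v v → Data.Empty.⊥
open Graph public

data Walk {n : ℕ} (E : Fin n → Fin n → Set) (P : Fin n → Set)
          : Fin n → Fin n → ℕ → Set where
  here : ∀ {v} → P v → Walk E P v v 0
  step : ∀ {u w v k} → P u → E u w → Walk E P w v k → Walk E P u v (suc k)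

-- dist_{H[P]}(u,v) ≤ d  (H is the graph with edge relation E on vertex set P)
DistLe : ∀ {n} → (Fin n → Fin n → Set) → (Fin n → Set) → Fin n → Fin n → ℕ → Set
DistLe E P u v d = Σ ℕ λ k → k ≤ d × Walk E P u v k

PowAdj : ∀ {n} → Graph n → ℕ → (Fin n → Set) → Fin n → Fin n → Set
PowAdj G ℓ P u v = u ≢ v × DistLe (Adj G) P u v ℓ

AllV : ∀ {n} → Fin n → Set
AllV _ = ⊤

Outside : ∀ {n} → Subset n → Fin n → Set
Outside Z v = v ∉ Z

Ball : ∀ {n} → Graph n → ℕ → Subset n → Fin n → Set
Ball G r S v = Σ (Fin _) λ s → s ∈ S × DistLe (Adj G) AllV v s r

MonoConn : ∀ {n m} → (Fin n → Fin n → Set) → (Fin n → Set) → (Fin n → Fin m)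
           → Fin n → Fin n → Set
MonoConn E P col u v = Σ ℕ λ k → Walk E (λ x → P x × col x ≡ col u) u v k

WeakDiamLe : ∀ {n m} → (Fin n → Fin n → Set) → (Fin n → Set) → (Fin n → Fin m) → ℕ → Set
WeakDiamLe E P col d = ∀ u v → P u → P v → MonoConn E P col u v → DistLe E P u v d

_∪ᶜ_[_] : ∀ {n m} → (Fin n → Fin m) → (Fin n → Fin m) → Subset n → Fin n → Fin m
(c ∪ᶜ cZ [ Z ]) v = if lookup Z v then cZ v else c v

module Submission where

-- Put R = ℓ + r and c' = c ∪ c_Z.  Take a c'-monochromatic walk
-- in G^ℓ.  Each of its G^ℓ-edges u w comes from a G-path of length ≤ ℓ which
-- either avoids Z (then u w is an edge of (G - Z)^ℓ with both ends outside Z,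
-- coloured by c), or meets some z ∈ Z; as z is within r of a hub s ∈ S, both
-- u and w are then within R of s in G.  So the walk becomes a "hub walk":
-- a sequence of steps inside (G - Z)^ℓ and jumps through hubs of S.
-- A maximal run of inside steps is a c-monochromatic walk in (G - Z)^ℓ, so
-- its ends are at distance ≤ N.  At the first jump, through hub s, we skip
-- to the last jump through s: the skipped part costs at most 2R, and the
-- rest of the walk only uses hubs of S - s.  Induction on the number of
-- hubs gives the bound N* = N + k (N + 2R), computed by `bound`.

open import Defs
open import Data.Nat using (ℕ; zero; suc; _+_; _≤_; _≥_; z≤n; s≤s)
open import Data.Nat.Properties
  using (≤-refl; ≤-trans; m≤m+n; +-mono-≤; <-≤-trans; n≮0; ≤-pred; m≤n⇒m≤1+n)
open import Data.Fin using (Fin; _≟_)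
open import Data.Fin.Subset using (Subset; _∈_; _∉_; ∣_∣; _-_)
open import Data.Fin.Subset.Properties using (_∈?_; x∈p∧x≢y⇒x∈p-y; x∈p⇒∣p-x∣<∣p∣)
open import Data.Product using (Σ; _×_; _,_; proj₂)
open import Data.Sum using (_⊎_; inj₁; inj₂)
open import Data.Unit using (tt)
open import Data.Empty using (⊥-elim)
open import Data.Bool using (true; false)
open import Data.Vec using (lookup)
open import Data.Vec.Properties using (lookup⇒[]=)
open import Relation.Nullary using (yes; no)
open import Relation.Binary.PropositionalEquality
  using (_≡_; refl; trans) renaming (sym to ≡-sym)

module _ {n : ℕ} {E : Fin n → Fin n → Set} {P : Fin n → Set} where

  walkStart : ∀ {u v k} → Walk E P u v k → P u
  walkStart (here p)     = p
  walkStart (step p _ _) = p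

  walkEnd : ∀ {u v k} → Walk E P u v k → P v
  walkEnd (here p)     = p
  walkEnd (step _ _ w) = walkEnd w

  appendWalk : ∀ {u w v i j} → Walk E P u w i → Walk E P w v j → Walk E P u v (i + j)
  appendWalk (here _)     q = q
  appendWalk (step p e w) q = step p e (appendWalk w q)

  snocWalk : ∀ {u w v k} → Walk E P u w k → P v → E w v → Walk E P u v (suc k)
  snocWalk (here p)     pv e′ = step p e′ (here pv)
  snocWalk (step p e w) pv e′ = step p e (snocWalk w pv e′)

  reverseWalk : (∀ {x y} → E x y → E y x) → ∀ {u v k} → Walk E P u v k → Walk E P v u k
  reverseWalk E-sym (here p)     = here p
  reverseWalk E-sym (step p e w) = snocWalk (reverseWalk E-sym w) p (E-sym e)

  distTrans : ∀ {u w v a b} → DistLe E P u w a → DistLe E P w v b → DistLe E P u v (a + b)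
  distTrans (i , i≤a , p) (j , j≤b , q) = i + j , +-mono-≤ i≤a j≤b , appendWalk p q

  distSym : (∀ {x y} → E x y → E y x) → ∀ {u v d} → DistLe E P u v d → DistLe E P v u d
  distSym E-sym (k , k≤d , p) = k , k≤d , reverseWalk E-sym p

  distMono : ∀ {u v a b} → a ≤ b → DistLe E P u v a → DistLe E P u v b
  distMono a≤b (k , k≤a , p) = k , ≤-trans k≤a a≤b , p

mapWalk : ∀ {n} {E E′ : Fin n → Fin n → Set} {P P′ : Fin n → Set} {u v k} →
  (∀ {x y} → E x y → E′ x y) → (∀ {x} → P x → P′ x) → Walk E P u v k → Walk E′ P′ u v k
mapWalk f g (here p)     = here (g p)
mapWalk f g (step p e w) = step (g p) (f e) (mapWalk f g w)

module _ {n : ℕ} (G : Graph n) (ℓ : ℕ) where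

  -- For ℓ ≥ 1 every edge of G is an edge of G^ℓ, so G-distances bound G^ℓ-distances.
  distToPow : ℓ ≥ 1 → ∀ {u v d} → DistLe (Adj G) AllV u v d → DistLe (PowAdj G ℓ AllV) AllV u v d
  distToPow ℓ≥1 (k , k≤d , p) = k , k≤d , mapWalk edgeToPow (λ x → x) p
    where
      edgeToPow : ∀ {x y} → Adj G x y → PowAdj G ℓ AllV x y
      edgeToPow e = (λ { refl → irrefl G e }) , 1 , ℓ≥1 , step tt e (here tt)

  -- (G[P])^ℓ is a subgraph of G^ℓ, so distances in it bound distances in G^ℓ.
  distFromInducedPow : ∀ {P : Fin n → Set} {u v d} →
    DistLe (PowAdj G ℓ P) P u v d → DistLe (PowAdj G ℓ AllV) AllV u v d
  distFromInducedPow (k , k≤d , p) = k , k≤d , mapWalk edgeFromInduced (λ _ → tt) p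
    where
      edgeFromInduced : ∀ {P : Fin n → Set} {x y} → PowAdj G ℓ P x y → PowAdj G ℓ AllV x y
      edgeFromInduced (x≢y , j , j≤ℓ , q) = x≢y , j , j≤ℓ , mapWalk (λ e → e) (λ _ → tt) q

  commonCentre : ℓ ≥ 1 → ∀ {a b s R} → DistLe (Adj G) AllV a s R → DistLe (Adj G) AllV b s R →
    DistLe (PowAdj G ℓ AllV) AllV a b (R + R)
  commonCentre ℓ≥1 as bs = distToPow ℓ≥1 (distTrans as (distSym (Graph.sym G) bs))

avoidsOrMeets : ∀ {n} {E : Fin n → Fin n → Set} (Z : Subset n) {u w k} → Walk E AllV u w k →
  Walk E (Outside Z) u w k ⊎
  Σ (Fin n) λ z → z ∈ Z × DistLe E AllV u z k × DistLe E AllV z w k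
avoidsOrMeets Z {u} (here _) with u ∈? Z
... | yes u∈Z = inj₂ (u , u∈Z , (0 , z≤n , here tt) , (0 , z≤n , here tt))
... | no  u∉Z = inj₁ (here u∉Z)
avoidsOrMeets Z {u} (step _ e w) with u ∈? Z
... | yes u∈Z = inj₂ (u , u∈Z , (0 , z≤n , here tt) , (_ , ≤-refl , step tt e w))
... | no  u∉Z with avoidsOrMeets Z w
...   | inj₁ w′ = inj₁ (step u∉Z e w′)
...   | inj₂ (z , z∈Z , (i , i≤k , a) , (j , j≤k , b)) =
          inj₂ (z , z∈Z , (suc i , s≤s i≤k , step tt e a) , (j , m≤n⇒m≤1+n j≤k , b))

-- The bound N* after using j hubs: bound R N j = N + j (N + 2R).
bound : ℕ → ℕ → ℕ → ℕ
bound R N zero    = N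
bound R N (suc j) = N + ((R + R) + bound R N j)

N≤bound : ∀ R N j → N ≤ bound R N j
N≤bound R N zero    = ≤-refl
N≤bound R N (suc j) = m≤m+n N _

module HubArgument {n : ℕ} (G : Graph n) (S Z : Subset n) (ℓ r N : ℕ) (ℓ≥1 : ℓ ≥ 1)
  (Z-near-S : ∀ v → v ∈ Z → Ball G r S v)
  {m : ℕ} (cZ c : Fin n → Fin m)
  (c-diam : WeakDiamLe (PowAdj G ℓ (Outside Z)) (Outside Z) c N) where

  R : ℕ
  R = ℓ + r

  PowG PowGZ : Fin n → Fin n → Set
  PowG  = PowAdj G ℓ AllV
  PowGZ = PowAdj G ℓ (Outside Z)

  Near : Fin n → Fin n → Set
  Near u s = DistLe (Adj G) AllV u s R

  c′ : Fin n → Fin m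
  c′ = c ∪ᶜ cZ [ Z ]

  c′-outside : ∀ {v} → v ∉ Z → c′ v ≡ c v
  c′-outside {v} v∉Z with lookup Z v in eq
  ... | true  = ⊥-elim (v∉Z (lookup⇒[]= v Z eq))
  ... | false = refl

  classifyEdge : ∀ {u w} → PowG u w →
    (u ∉ Z × w ∉ Z × PowGZ u w) ⊎ (Σ (Fin n) λ s → s ∈ S × Near u s × Near w s)
  classifyEdge (u≢w , k , k≤ℓ , p) with avoidsOrMeets Z p
  ... | inj₁ q = inj₁ (walkStart q , walkEnd q , u≢w , k , k≤ℓ , q)
  ... | inj₂ (z , z∈Z , uz , zw) with Z-near-S z z∈Z
  ...   | s , s∈S , zs = inj₂ (s , s∈S , distTrans (distMono k≤ℓ uz) zs
                                      , distTrans (distSym (Graph.sym G) (distMono k≤ℓ zw)) zs)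

  data HubWalk (col : Fin m) (T : Subset n) : Fin n → Fin n → Set where
    stop   : ∀ {v} → HubWalk col T v v
    inside : ∀ {u w v} → u ∉ Z → w ∉ Z → c u ≡ col → c w ≡ col → PowGZ u w →
             HubWalk col T w v → HubWalk col T u v
    viaHub : ∀ {u w v} (s : Fin n) → s ∈ T → Near u s → Near w s →
             HubWalk col T w v → HubWalk col T u v

  toHubWalk : ∀ {col u v k} → Walk PowG (λ x → AllV x × c′ x ≡ col) u v k → HubWalk col S u v
  toHubWalk (here _) = stop
  toHubWalk (step (_ , c′u) e w) with classifyEdge e
  ... | inj₁ (u∉Z , w∉Z , e′) =
          inside u∉Z w∉Z (trans (≡-sym (c′-outside u∉Z)) c′u)
                 (trans (≡-sym (c′-outside w∉Z)) (proj₂ (walkStart w))) e′ (toHubWalk w)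
  ... | inj₂ (s , s∈S , us , ws) = viaHub s s∈S us ws (toHubWalk w)

  InsideRun : Fin m → Fin n → Fin n → Set
  InsideRun col u a = u ≡ a ⊎ Σ ℕ λ k → Walk PowGZ (λ x → Outside Z x × c x ≡ col) u a k

  extendRun : ∀ {col u w a} → u ∉ Z → w ∉ Z → c u ≡ col → c w ≡ col → PowGZ u w →
    InsideRun col w a → InsideRun col u a
  extendRun u∉Z w∉Z cu cw e (inj₁ refl)   = inj₂ (1 , step (u∉Z , cu) e (here (w∉Z , cw)))
  extendRun u∉Z w∉Z cu cw e (inj₂ (k , q)) = inj₂ (suc k , step (u∉Z , cu) e q)

  runDist : ∀ {col u a} → InsideRun col u a → DistLe PowG AllV u a N
  runDist (inj₁ refl) = 0 , z≤n , here tt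
  runDist {u = u} {a} (inj₂ (k , q)) with walkStart q | walkEnd q
  ... | u∉Z , cu | a∉Z , _ =
    distFromInducedPow G ℓ
      (c-diam u a u∉Z a∉Z (k , mapWalk (λ e → e) (λ { (x∉Z , cx) → x∉Z , trans cx (≡-sym cu) }) q))

  FirstJump : Fin m → Subset n → Fin n → Fin n → Set
  FirstJump col T u v = InsideRun col u v ⊎
    Σ (Fin n) λ a → Σ (Fin n) λ b → Σ (Fin n) λ s →
      InsideRun col u a × s ∈ T × Near a s × Near b s × HubWalk col T b v

  firstJump : ∀ {col T u v} → HubWalk col T u v → FirstJump col T u v
  firstJump stop = inj₁ (inj₁ refl)
  firstJump (inside u∉Z w∉Z cu cw e w) with firstJump w
  ... | inj₁ run = inj₁ (extendRun u∉Z w∉Z cu cw e run)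
  ... | inj₂ (a , b , s , run , s∈T , as , bs , w′) =
          inj₂ (a , b , s , extendRun u∉Z w∉Z cu cw e run , s∈T , as , bs , w′)
  firstJump (viaHub s s∈T us ws w) = inj₂ (_ , _ , s , inj₁ refl , s∈T , us , ws , w)

  dropHub : ∀ {col T w v} (s : Fin n) → HubWalk col T w v →
    HubWalk col (T - s) w v ⊎ Σ (Fin n) λ b → Near b s × HubWalk col (T - s) b v
  dropHub s stop = inj₁ stop
  dropHub s (inside u∉Z w∉Z cu cw e w) with dropHub s w
  ... | inj₁ w′   = inj₁ (inside u∉Z w∉Z cu cw e w′)
  ... | inj₂ tail = inj₂ tail
  dropHub s (viaHub s′ s′∈T us′ ws′ w) with dropHub s w
  ... | inj₂ tail = inj₂ tail
  ... | inj₁ w′ with s′ ≟ s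
  ...   | yes refl = inj₂ (_ , ws′ , w′)
  ...   | no  s′≢s = inj₁ (viaHub s′ (x∈p∧x≢y⇒x∈p-y s′∈T s′≢s) us′ ws′ w′)

  skipToLastVisit : ∀ {col T b v} (s : Fin n) → Near b s → HubWalk col T b v →
    Σ (Fin n) λ b′ → Near b′ s × HubWalk col (T - s) b′ v
  skipToLastVisit s bs w with dropHub s w
  ... | inj₁ w′   = _ , bs , w′
  ... | inj₂ tail = tail

  hubWalkDist : ∀ {col u v} j (T : Subset n) → ∣ T ∣ ≤ j → HubWalk col T u v →
    DistLe PowG AllV u v (bound R N j)
  hubWalkDist j T |T|≤j w with firstJump w
  ... | inj₁ run = distMono (N≤bound R N j) (runDist run)
  hubWalkDist zero T |T|≤0 w | inj₂ (_ , _ , s , _ , s∈T , _) =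
    ⊥-elim (n≮0 (<-≤-trans (x∈p⇒∣p-x∣<∣p∣ s∈T) |T|≤0))
  hubWalkDist (suc j) T |T|≤j w | inj₂ (a , b , s , run , s∈T , as , bs , rest)
    with skipToLastVisit s bs rest
  ... | b′ , b′s , rest′ =
    distTrans (runDist run)
      (distTrans (commonCentre G ℓ ℓ≥1 as b′s)
        (hubWalkDist j (T - s) (≤-pred (≤-trans (x∈p⇒∣p-x∣<∣p∣ s∈T) |T|≤j)) rest′))

lemma4p1 : (k r ℓ N : ℕ) → ℓ ≥ 1 → N ≥ 1 →
    Σ ℕ λ N* → N* ≥ N ×
    ((n : ℕ) (G : Graph n) (S Z : Subset n) → ∣ S ∣ ≤ k →
    (∀ v → v ∈ Z → Ball G r S v) →
    (m : ℕ) → m ≥ 1 → (cZ c : Fin n → Fin m) →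
    WeakDiamLe (PowAdj G ℓ (Outside Z)) (Outside Z) c N →
    WeakDiamLe (PowAdj G ℓ AllV) AllV (c ∪ᶜ cZ [ Z ]) N*)
lemma4p1 k r ℓ N ℓ≥1 _ =
  bound (ℓ + r) N k , N≤bound (ℓ + r) N k ,
  λ n G S Z |S|≤k Z-near-S m _ cZ c c-diam u v _ _ (_ , mono-walk) →
    let open HubArgument G S Z ℓ r N ℓ≥1 Z-near-S cZ c c-diam
    in hubWalkDist k S |S|≤k (toHubWalk mono-walk)
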